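{- If $(F_{\mathbf{j}})$, $\mathbf{j}\in\mathbb{N}^{\ell}$, and $(H_{\mathbf{k}})$, $\mathbf{k}\in\mathbb{N}^h$, are polynomial (respectively strongly polynomial) sequences of graphs, then the sequences $(F_{\mathbf{j}}\cup H_{\mathbf{k}})$ of disjoint unions and $(F_{\mathbf{j}}\times H_{\mathbf{k}})$ of categorical products are polynomial (respectively strongly polynomial) in $(\mathbf{j},\mathbf{k})$.
   Context: Graphs are finite (loops/weights allowed); for a multigraph $G$, $\mathrm{hom}(G,H)$ counts (weighted) homomorphisms. $\mathbb{N}$ denotes the positive integers. A sequence $(H_{\mathbf{k}})$ indexed by all $\mathbf{k}\in\mathbb{N}^h$ is polynomial if for every graph $G$ there are finitely many polynomials $p_1(G;\mathbf{x}),\dots,p_m(G;\mathbf{x})$ such that for every $\mathbf{k}$, $\mathrm{hom}(G,H_{\mathbf{k}})=p_\ell(G;\mathbf{k})$ for some $\ell$; it is strongly polynomial if a single polynomial works for all $\mathbf{k}$. Convention for combining sequences: each coordinate of $\mathbf{k}$ is either equal to some coordinate of $\mathbf{j}$ or independent of all coordinates of $\mathbf{j}$, and vice versa; the combined sequence is indexed by the distinct variables among the coordinates of $\mathbf{j}$ and $\mathbf{k}$, denoted $(\mathbf{j},\mathbf{k})$. The categorical product $G\times H$ has vertex set $V(G)\times V(H)$, with $(u,v)\sim(u',v')$ iff $uu'\in E(G)$ and $vv'\in E(H)$. -}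

module Defs where

open import Level using (Level; _⊔_)
open import Algebra.Bundles using (CommutativeSemiring)
open import Data.Nat using (ℕ; zero; suc)
import Data.Nat as N
open import Data.Fin using (Fin; splitAt; remQuot)
open import Data.Fin.Base using (Fin)
open import Data.List using (List; []; _∷_; map; concatMap; foldr)
open import Data.List.Base using ([_])
open import Data.Product using (Σ; ∃; _×_; _,_; proj₁; proj₂)
open import Data.Sum using (_⊎_; inj₁; inj₂)
import Data.Vec.Functional as VF
open import Data.Fin.Base using (zero; suc)
import Data.List.Base as L
open import Function.Definitions using (Injective)
open import Relation.Binary.PropositionalEquality using (_≡_)

allFins : ∀ n → List (Fin n)
allFins zero = []
allFins (suc n) = zero ∷ map suc (allFins n)

funs : ∀ m n → List (Fin m → Fin n)
funs zero n = [ (λ ()) ]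
funs (suc m) n = concatMap (λ f → map (λ i → i VF.∷ f) (allFins n)) (funs m n)

-- A finite multigraph (loops and parallel edges allowed), used as the
-- source graph G of hom(G, H): vertex set Fin vertices, edges a list of
-- (unordered, stored as ordered) pairs of endpoints.
record MultiGraph : Set where
  constructor mkMG
  field
    vertices : ℕ
    edges    : List (Fin vertices × Fin vertices)

module _ {c ℓ : Level} (R : CommutativeSemiring c ℓ) where
  open CommutativeSemiring R

  -- A finite weighted (undirected) graph with loops: vertex set Fin size,
  -- symmetric edge-weight matrix with entries in R (weight 0# = no edge).
  record WGraph : Set (c ⊔ ℓ) where
    constructor mkWG
    field
      size   : ℕ
      weight : Fin size → Fin size → Carrier
      symm   : ∀ i j → weight i j ≈ weight j i

  open WGraph public

  sumR : List Carrier → Carrier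
  sumR = foldr _+_ 0#

  prodR : List Carrier → Carrier
  prodR = foldr _*_ 1#

  hom : MultiGraph → WGraph → Carrier
  hom G H = sumR (map (λ φ → prodR (map (λ e → weight H (φ (proj₁ e)) (φ (proj₂ e)))
                                        (MultiGraph.edges G)))
                      (funs (MultiGraph.vertices G) (size H)))

  private
    uw : (F H : WGraph) → Fin (size F) ⊎ Fin (size H) → Fin (size F) ⊎ Fin (size H) → Carrier
    uw F H (inj₁ a) (inj₁ b) = weight F a b
    uw F H (inj₁ a) (inj₂ b) = 0#
    uw F H (inj₂ a) (inj₁ b) = 0#
    uw F H (inj₂ a) (inj₂ b) = weight H a b

    uw-sym : (F H : WGraph) → ∀ x y → uw F H x y ≈ uw F H y x
    uw-sym F H (inj₁ a) (inj₁ b) = symm F a b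
    uw-sym F H (inj₁ a) (inj₂ b) = refl
    uw-sym F H (inj₂ a) (inj₁ b) = refl
    uw-sym F H (inj₂ a) (inj₂ b) = symm H a b

  _∪G_ : WGraph → WGraph → WGraph
  F ∪G H = mkWG (size F N.+ size H)
                (λ i j → uw F H (splitAt (size F) i) (splitAt (size F) j))
                (λ i j → uw-sym F H (splitAt (size F) i) (splitAt (size F) j))

  private
    pw : (F H : WGraph) → Fin (size F) × Fin (size H) → Fin (size F) × Fin (size H) → Carrier
    pw F H (a , b) (a' , b') = weight F a a' * weight H b b'

    pw-sym : (F H : WGraph) → ∀ x y → pw F H x y ≈ pw F H y x
    pw-sym F H (a , b) (a' , b') = *-cong (symm F a a') (symm H b b')

  _×G_ : WGraph → WGraph → WGraph
  F ×G H = mkWG (size F N.* size H)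
                (λ i j → pw F H (remQuot {size F} (size H) i) (remQuot {size F} (size H) j))
                (λ i j → pw-sym F H (remQuot {size F} (size H) i) (remQuot {size F} (size H) j))

  data Poly (h : ℕ) : Set c where
    con : Carrier → Poly h
    var : Fin h → Poly h
    _⊕_ : Poly h → Poly h → Poly h
    _⊗_ : Poly h → Poly h → Poly h

  eval : ∀ {h} → Poly h → (Fin h → Carrier) → Carrier
  eval (con a) x = a
  eval (var i) x = x i
  eval (p ⊕ q) x = eval p x + eval q x
  eval (p ⊗ q) x = eval p x * eval q x

  ℕ→R : ℕ → Carrier
  ℕ→R zero = 0#
  ℕ→R (suc n) = 1# + ℕ→R n

  -- A sequence indexed by N^h (N = positive integers).  An index k ∈ N^h is
  -- represented by κ : Fin h → ℕ with k_i = suc (κ i).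
  Index : ℕ → Set
  Index h = Fin h → ℕ

  pt : ∀ {h} → Index h → Fin h → Carrier
  pt κ i = ℕ→R (suc (κ i))

  Sequence : ℕ → Set (c ⊔ ℓ)
  Sequence h = Index h → WGraph

  IsPolynomial : ∀ {h} → Sequence h → Set (c ⊔ ℓ)
  IsPolynomial {h} H =
    (G : MultiGraph) → Σ ℕ λ m → Σ (Fin m → Poly h) λ ps →
      (κ : Index h) → Σ (Fin m) λ l → hom G (H κ) ≈ eval (ps l) (pt κ)

  IsStronglyPolynomial : ∀ {h} → Sequence h → Set (c ⊔ ℓ)
  IsStronglyPolynomial {h} H =
    (G : MultiGraph) → Σ (Poly h) λ p →
      (κ : Index h) → hom G (H κ) ≈ eval p (pt κ)

  -- Combining index variables: the variables of j (ℓ' of them) and of k (h of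
  -- them) are identified with distinct variables among d combined ones via
  -- injective maps σ, τ, jointly covering all d variables.
  record Combine (l h d : ℕ) : Set where
    field
      σ     : Fin l → Fin d
      τ     : Fin h → Fin d
      σ-inj : Injective _≡_ _≡_ σ
      τ-inj : Injective _≡_ _≡_ τ
      cover : ∀ x → (∃ λ i → σ i ≡ x) ⊎ (∃ λ i → τ i ≡ x)

  combineWith : ∀ {l h d} → (WGraph → WGraph → WGraph) → Combine l h d →
                Sequence l → Sequence h → Sequence d
  combineWith op C F H κ = op (F (λ i → κ (Combine.σ C i))) (H (λ i → κ (Combine.τ C i)))

-- A map into F ×G H is a pair of maps into F and H, and edge weights multiply,
-- so hom(G, F ×G H) = hom(G, F) · hom(G, H).  A map into F ∪G H amounts to a
-- 2-colouring s of V(G) with maps of the two colour classes into F and H; its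
-- weight vanishes if some edge joins the classes, so
--   hom(G, F ∪G H) = Σ_s [no edge of G is bichromatic] · hom(G[s⁻¹0], F) · hom(G[s⁻¹1], H),
-- a sum over finitely many colourings independent of the indices.  Both kinds of
-- polynomial families contain the constants and are closed under +, · and
-- renaming of variables, so these identities transfer (strong) polynomiality.

module Submission where

open import Defs
open import Level using (Level; _⊔_)
open import Algebra.Bundles using (CommutativeSemiring)
import Algebra.Properties.CommutativeSemigroup as CommutativeSemigroupProperties
open import Data.Nat using (ℕ; zero; suc)
import Data.Nat as ℕ
open import Data.Fin using (Fin; zero; suc; _↑ˡ_; _↑ʳ_; join; combine; remQuot)
open import Data.Fin.Properties using (splitAt-↑ˡ; splitAt-↑ʳ; remQuot-combine)
open import Data.List using (List; []; _∷_; map; _++_; concatMap)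
open import Data.Product using (Σ; _×_; _,_; proj₁; proj₂)
open import Data.Sum using (_⊎_; inj₁; inj₂)
import Data.Sum as Sum
import Data.Vec.Functional as Vector
open import Data.Vec.Functional.Properties using (∷-cong)
open import Relation.Binary.PropositionalEquality as ≡ using (_≡_; _≗_)

open MultiGraph using (vertices; edges)

-- A colouring sends a vertex to the left (colour 0) or to the right (colour 1)
-- part; `side s` numbers the vertices of each colour consecutively.
Colouring : ℕ → Set
Colouring m = Fin m → Fin 2

private
  sucIfLeft : Fin 2 → ℕ → ℕ
  sucIfLeft zero    k = suc k
  sucIfLeft (suc _) k = k

  sucIfRight : Fin 2 → ℕ → ℕ
  sucIfRight zero    k = k
  sucIfRight (suc _) k = suc k

#left : ∀ {m} → Colouring m → ℕ
#left {zero}  s = 0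
#left {suc m} s = sucIfLeft (s zero) (#left (λ i → s (suc i)))

#right : ∀ {m} → Colouring m → ℕ
#right {zero}  s = 0
#right {suc m} s = sucIfRight (s zero) (#right (λ i → s (suc i)))

private
  sideStep : ∀ {m k k′} (b : Fin 2) → (Fin m → Fin k ⊎ Fin k′) →
             Fin (suc m) → Fin (sucIfLeft b k) ⊎ Fin (sucIfRight b k′)
  sideStep zero       p zero    = inj₁ zero
  sideStep zero       p (suc i) = Sum.map₁ suc (p i)
  sideStep (suc zero) p zero    = inj₂ zero
  sideStep (suc zero) p (suc i) = Sum.map₂ suc (p i)

side : ∀ {m} (s : Colouring m) → Fin m → Fin (#left s) ⊎ Fin (#right s)
side {suc m} s = sideStep (s zero) (side (λ i → s (suc i)))

glue : ∀ {m a b} (s : Colouring m) → (Fin (#left s) → Fin a) → (Fin (#right s) → Fin b) →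
       Fin m → Fin (a ℕ.+ b)
glue {a = a} {b} s α β i = join a b (Sum.map α β (side s i))

glue-left : ∀ {m a b} (s : Colouring m) (x : Fin a) α β →
  glue {b = b} (zero Vector.∷ s) (x Vector.∷ α) β ≗ (x ↑ˡ b) Vector.∷ glue s α β
glue-left s x α β zero    = ≡.refl
glue-left s x α β (suc i) with side s i
... | inj₁ _ = ≡.refl
... | inj₂ _ = ≡.refl

glue-right : ∀ {m a b} (s : Colouring m) (y : Fin b) α β →
  glue {a = a} (suc zero Vector.∷ s) α (y Vector.∷ β) ≗ (a ↑ʳ y) Vector.∷ glue s α β
glue-right s y α β zero    = ≡.refl
glue-right s y α β (suc i) with side s i
... | inj₁ _ = ≡.refl
... | inj₂ _ = ≡.refl

Edges : ℕ → Set
Edges m = List (Fin m × Fin m)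

leftEdges : ∀ {m} (s : Colouring m) → Edges m → Edges (#left s)
leftEdges s []             = []
leftEdges s ((u , v) ∷ es) with side s u | side s v
... | inj₁ p | inj₁ q = (p , q) ∷ leftEdges s es
... | _      | _      = leftEdges s es

rightEdges : ∀ {m} (s : Colouring m) → Edges m → Edges (#right s)
rightEdges s []             = []
rightEdges s ((u , v) ∷ es) with side s u | side s v
... | inj₂ p | inj₂ q = (p , q) ∷ rightEdges s es
... | _      | _      = rightEdges s es

leftSubgraph rightSubgraph : (G : MultiGraph) → Colouring (vertices G) → MultiGraph
leftSubgraph  G s = mkMG (#left s)  (leftEdges s (edges G))
rightSubgraph G s = mkMG (#right s) (rightEdges s (edges G))

module _ {c r : Level} (R : CommutativeSemiring c r) where
  open CommutativeSemiring R hiding (zero)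
  open import Relation.Binary.Reasoning.Setoid setoid
  private
    module +-Props = CommutativeSemigroupProperties +-commutativeSemigroup
    module *-Props = CommutativeSemigroupProperties *-commutativeSemigroup

  ∑ : {A : Set} → List A → (A → Carrier) → Carrier
  ∑ xs f = sumR R (map f xs)

  ∏ : {A : Set} → List A → (A → Carrier) → Carrier
  ∏ xs f = prodR R (map f xs)

  syntax ∑ xs (λ x → f) = ∑[ x ∈ xs ] f
  syntax ∏ xs (λ x → f) = ∏[ x ∈ xs ] f

  ∑-cong : {A : Set} (xs : List A) {f g : A → Carrier} → (∀ x → f x ≈ g x) → ∑ xs f ≈ ∑ xs g
  ∑-cong []       f≈g = refl
  ∑-cong (x ∷ xs) f≈g = +-cong (f≈g x) (∑-cong xs f≈g)

  ∏-cong : {A : Set} (xs : List A) {f g : A → Carrier} → (∀ x → f x ≈ g x) → ∏ xs f ≈ ∏ xs g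
  ∏-cong []       f≈g = refl
  ∏-cong (x ∷ xs) f≈g = *-cong (f≈g x) (∏-cong xs f≈g)

  ∑-distrib-+ : {A : Set} (xs : List A) (f g : A → Carrier) →
                ∑[ x ∈ xs ] (f x + g x) ≈ ∑ xs f + ∑ xs g
  ∑-distrib-+ []       f g = sym (+-identityˡ 0#)
  ∑-distrib-+ (x ∷ xs) f g =
    trans (+-cong refl (∑-distrib-+ xs f g)) (+-Props.interchange (f x) (g x) (∑ xs f) (∑ xs g))

  ∏-distrib-* : {A : Set} (xs : List A) (f g : A → Carrier) →
                ∏[ x ∈ xs ] (f x * g x) ≈ ∏ xs f * ∏ xs g
  ∏-distrib-* []       f g = sym (*-identityˡ 1#)
  ∏-distrib-* (x ∷ xs) f g =
    trans (*-cong refl (∏-distrib-* xs f g)) (*-Props.interchange (f x) (g x) (∏ xs f) (∏ xs g))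

  ∑-++ : {A : Set} (xs ys : List A) (f : A → Carrier) → ∑ (xs ++ ys) f ≈ ∑ xs f + ∑ ys f
  ∑-++ []       ys f = sym (+-identityˡ _)
  ∑-++ (x ∷ xs) ys f = trans (+-cong refl (∑-++ xs ys f)) (sym (+-assoc _ _ _))

  ∑-map : {A B : Set} (g : A → B) (xs : List A) (f : B → Carrier) →
          ∑ (map g xs) f ≈ ∑[ x ∈ xs ] f (g x)
  ∑-map g []       f = refl
  ∑-map g (x ∷ xs) f = +-cong refl (∑-map g xs f)

  ∑-concatMap : {A B : Set} (g : A → List B) (xs : List A) (f : B → Carrier) →
                ∑ (concatMap g xs) f ≈ ∑[ x ∈ xs ] ∑ (g x) f
  ∑-concatMap g []       f = refl
  ∑-concatMap g (x ∷ xs) f = trans (∑-++ (g x) _ f) (+-cong refl (∑-concatMap g xs f))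

  ∑-zero : {A : Set} (xs : List A) → ∑[ x ∈ xs ] 0# ≈ 0#
  ∑-zero []       = refl
  ∑-zero (x ∷ xs) = trans (+-identityˡ _) (∑-zero xs)

  *-distribˡ-∑ : {A : Set} (k : Carrier) (xs : List A) (f : A → Carrier) →
                 k * ∑ xs f ≈ ∑[ x ∈ xs ] (k * f x)
  *-distribˡ-∑ k []       f = zeroʳ k
  *-distribˡ-∑ k (x ∷ xs) f = trans (distribˡ k _ _) (+-cong refl (*-distribˡ-∑ k xs f))

  *-distribʳ-∑ : {A : Set} (k : Carrier) (xs : List A) (f : A → Carrier) →
                 ∑ xs f * k ≈ ∑[ x ∈ xs ] (f x * k)
  *-distribʳ-∑ k []       f = zeroˡ k
  *-distribʳ-∑ k (x ∷ xs) f = trans (distribʳ k _ _) (+-cong refl (*-distribʳ-∑ k xs f))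

  ∑-comm : {A B : Set} (xs : List A) (ys : List B) (f : A → B → Carrier) →
           ∑[ x ∈ xs ] ∑[ y ∈ ys ] f x y ≈ ∑[ y ∈ ys ] ∑[ x ∈ xs ] f x y
  ∑-comm []       ys f = sym (∑-zero ys)
  ∑-comm (x ∷ xs) ys f = trans (+-cong refl (∑-comm xs ys f)) (sym (∑-distrib-+ ys (f x) _))

  ∑-*-∑ : {A B : Set} (xs : List A) (ys : List B) (f : A → Carrier) (g : B → Carrier) →
          ∑[ x ∈ xs ] ∑[ y ∈ ys ] (f x * g y) ≈ ∑ xs f * ∑ ys g
  ∑-*-∑ xs ys f g = begin
    ∑[ x ∈ xs ] ∑[ y ∈ ys ] (f x * g y) ≈⟨ ∑-cong xs (λ x → *-distribˡ-∑ (f x) ys g) ⟨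
    ∑[ x ∈ xs ] (f x * ∑ ys g)          ≈⟨ *-distribʳ-∑ (∑ ys g) xs f ⟨
    ∑ xs f * ∑ ys g                     ∎

  ∑-scaled-*-∑ : {A B : Set} (k : Carrier) (xs : List A) (ys : List B)
                 (f : A → Carrier) (g : B → Carrier) →
    ∑[ x ∈ xs ] ∑[ y ∈ ys ] (k * (f x * g y)) ≈ k * (∑ xs f * ∑ ys g)
  ∑-scaled-*-∑ k xs ys f g = begin
    ∑[ x ∈ xs ] ∑[ y ∈ ys ] (k * (f x * g y))
      ≈⟨ ∑-cong xs (λ x → ∑-cong ys (λ y → *-assoc k (f x) (g y))) ⟨
    ∑[ x ∈ xs ] ∑[ y ∈ ys ] ((k * f x) * g y)
      ≈⟨ ∑-*-∑ xs ys (λ x → k * f x) g ⟩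
    ∑[ x ∈ xs ] (k * f x) * ∑ ys g
      ≈⟨ *-cong (*-distribˡ-∑ k xs f) refl ⟨
    (k * ∑ xs f) * ∑ ys g
      ≈⟨ *-assoc k (∑ xs f) (∑ ys g) ⟩
    k * (∑ xs f * ∑ ys g) ∎

  ∑-allFins-+ : ∀ a b (g : Fin (a ℕ.+ b) → Carrier) →
    ∑ (allFins (a ℕ.+ b)) g ≈ ∑[ x ∈ allFins a ] g (x ↑ˡ b) + ∑[ y ∈ allFins b ] g (a ↑ʳ y)
  ∑-allFins-+ zero    b g = sym (+-identityˡ _)
  ∑-allFins-+ (suc a) b g = begin
    g zero + ∑ (map suc (allFins (a ℕ.+ b))) g
      ≈⟨ +-cong refl (∑-map suc (allFins (a ℕ.+ b)) g) ⟩
    g zero + ∑[ i ∈ allFins (a ℕ.+ b) ] g (suc i)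
      ≈⟨ +-cong refl (∑-allFins-+ a b (λ i → g (suc i))) ⟩
    g zero + (∑[ x ∈ allFins a ] g (suc (x ↑ˡ b)) + ∑[ y ∈ allFins b ] g (suc a ↑ʳ y))
      ≈⟨ +-assoc _ _ _ ⟨
    (g zero + ∑[ x ∈ allFins a ] g (suc (x ↑ˡ b))) + ∑[ y ∈ allFins b ] g (suc a ↑ʳ y)
      ≈⟨ +-cong (+-cong refl (∑-map suc (allFins a) (λ x → g (x ↑ˡ b)))) refl ⟨
    ∑[ x ∈ allFins (suc a) ] g (x ↑ˡ b) + ∑[ y ∈ allFins b ] g (suc a ↑ʳ y) ∎

  ∑-allFins-* : ∀ a b (g : Fin (a ℕ.* b) → Carrier) →
    ∑ (allFins (a ℕ.* b)) g ≈ ∑[ x ∈ allFins a ] ∑[ y ∈ allFins b ] g (combine x y)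
  ∑-allFins-* zero    b g = refl
  ∑-allFins-* (suc a) b g = begin
    ∑ (allFins (b ℕ.+ a ℕ.* b)) g
      ≈⟨ ∑-allFins-+ b (a ℕ.* b) g ⟩
    ∑[ y ∈ allFins b ] g (y ↑ˡ a ℕ.* b) + ∑[ i ∈ allFins (a ℕ.* b) ] g (b ↑ʳ i)
      ≈⟨ +-cong refl (∑-allFins-* a b (λ i → g (b ↑ʳ i))) ⟩
    ∑[ y ∈ allFins b ] g (y ↑ˡ a ℕ.* b) + ∑[ x ∈ allFins a ] ∑[ y ∈ allFins b ] g (combine (suc x) y)
      ≈⟨ +-cong refl (∑-map suc (allFins a) (λ x → ∑[ y ∈ allFins b ] g (combine x y))) ⟨
    ∑[ x ∈ allFins (suc a) ] ∑[ y ∈ allFins b ] g (combine x y) ∎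

  ∑-funs-suc : ∀ m n (Φ : (Fin (suc m) → Fin n) → Carrier) →
    ∑ (funs (suc m) n) Φ ≈ ∑[ φ ∈ funs m n ] ∑[ i ∈ allFins n ] Φ (i Vector.∷ φ)
  ∑-funs-suc m n Φ = trans (∑-concatMap _ (funs m n) Φ)
    (∑-cong (funs m n) (λ φ → ∑-map (Vector._∷ φ) (allFins n) Φ))

  -- Without function extensionality, sums over maps Fin m → Fin n can only be
  -- reindexed for summands that respect pointwise equality of maps.
  PointwiseCongruent : {A : Set} {m : ℕ} → ((Fin m → A) → Carrier) → Set r
  PointwiseCongruent Φ = ∀ {φ ψ} → φ ≗ ψ → Φ φ ≈ Φ ψ

  ∷-pointwiseCongruent : {A : Set} {m : ℕ} {Φ : (Fin (suc m) → A) → Carrier} →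
    PointwiseCongruent Φ → ∀ x → PointwiseCongruent (λ φ → Φ (x Vector.∷ φ))
  ∷-pointwiseCongruent Φ-cong x φ≗ψ = Φ-cong (∷-cong ≡.refl φ≗ψ)

  ∑-funs-* : ∀ m a b (Φ : (Fin m → Fin (a ℕ.* b)) → Carrier) → PointwiseCongruent Φ →
    ∑ (funs m (a ℕ.* b)) Φ ≈
    ∑[ α ∈ funs m a ] ∑[ β ∈ funs m b ] Φ (λ i → combine (α i) (β i))
  ∑-funs-* zero    a b Φ Φ-cong = +-cong (trans (Φ-cong λ ()) (sym (+-identityʳ _))) refl
  ∑-funs-* (suc m) a b Φ Φ-cong = begin
    ∑ (funs (suc m) (a ℕ.* b)) Φ
      ≈⟨ ∑-funs-suc m (a ℕ.* b) Φ ⟩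
    ∑[ φ ∈ funs m (a ℕ.* b) ] ∑[ i ∈ allFins (a ℕ.* b) ] Φ (i Vector.∷ φ)
      ≈⟨ ∑-cong (funs m (a ℕ.* b)) (λ φ → ∑-allFins-* a b (λ i → Φ (i Vector.∷ φ))) ⟩
    ∑ (funs m (a ℕ.* b)) Ψ
      ≈⟨ ∑-funs-* m a b Ψ Ψ-cong ⟩
    ∑[ α ∈ funs m a ] ∑[ β ∈ funs m b ] ∑[ x ∈ allFins a ] ∑[ y ∈ allFins b ]
      Φ (combine x y Vector.∷ λ i → combine (α i) (β i))
      ≈⟨ ∑-cong (funs m a) (λ α → ∑-comm (funs m b) (allFins a) _) ⟩
    ∑[ α ∈ funs m a ] ∑[ x ∈ allFins a ] ∑[ β ∈ funs m b ] ∑[ y ∈ allFins b ]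
      Φ (combine x y Vector.∷ λ i → combine (α i) (β i))
      ≈⟨ ∑-cong (funs m a) (λ α → ∑-cong (allFins a) (λ x → ∑-cong (funs m b) (λ β →
           ∑-cong (allFins b) (λ y → Φ-cong (∷-cong ≡.refl λ _ → ≡.refl))))) ⟩
    ∑[ α ∈ funs m a ] ∑[ x ∈ allFins a ] ∑[ β ∈ funs m b ] ∑[ y ∈ allFins b ]
      Φ (λ i → combine ((x Vector.∷ α) i) ((y Vector.∷ β) i))
      ≈⟨ ∑-cong (funs m a) (λ α → ∑-cong (allFins a) (λ x → ∑-funs-suc m b _)) ⟨
    ∑[ α ∈ funs m a ] ∑[ x ∈ allFins a ]
      ∑ (funs (suc m) b) (λ β → Φ (λ i → combine ((x Vector.∷ α) i) (β i)))
      ≈⟨ ∑-funs-suc m a _ ⟨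
    ∑[ α ∈ funs (suc m) a ] ∑[ β ∈ funs (suc m) b ] Φ (λ i → combine (α i) (β i)) ∎
    where
    Ψ : (Fin m → Fin (a ℕ.* b)) → Carrier
    Ψ φ = ∑[ x ∈ allFins a ] ∑[ y ∈ allFins b ] Φ (combine x y Vector.∷ φ)
    Ψ-cong : PointwiseCongruent Ψ
    Ψ-cong φ≗ψ = ∑-cong (allFins a) (λ x → ∑-cong (allFins b) (λ y →
      ∷-pointwiseCongruent Φ-cong _ φ≗ψ))


  ∑-colourings-suc : ∀ m (Φ : Colouring (suc m) → Carrier) →
    ∑ (funs (suc m) 2) Φ ≈ ∑[ s ∈ funs m 2 ] (Φ (zero Vector.∷ s) + Φ (suc zero Vector.∷ s))
  ∑-colourings-suc m Φ =
    trans (∑-funs-suc m 2 Φ) (∑-cong (funs m 2) (λ s → +-cong refl (+-identityʳ _)))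

  ∑-funs-+ : ∀ m a b (Φ : (Fin m → Fin (a ℕ.+ b)) → Carrier) → PointwiseCongruent Φ →
    ∑ (funs m (a ℕ.+ b)) Φ ≈
    ∑[ s ∈ funs m 2 ] ∑[ α ∈ funs (#left s) a ] ∑[ β ∈ funs (#right s) b ] Φ (glue s α β)
  ∑-funs-+ zero    a b Φ Φ-cong =
    +-cong (trans (Φ-cong λ ()) (sym (trans (+-identityʳ _) (+-identityʳ _)))) refl
  ∑-funs-+ (suc m) a b Φ Φ-cong = begin
    ∑ (funs (suc m) (a ℕ.+ b)) Φ
      ≈⟨ ∑-funs-suc m (a ℕ.+ b) Φ ⟩
    ∑[ φ ∈ funs m (a ℕ.+ b) ] ∑[ i ∈ allFins (a ℕ.+ b) ] Φ (i Vector.∷ φ)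
      ≈⟨ ∑-cong (funs m (a ℕ.+ b)) (λ φ → ∑-allFins-+ a b (λ i → Φ (i Vector.∷ φ))) ⟩
    ∑[ φ ∈ funs m (a ℕ.+ b) ] (Ψˡ φ + Ψʳ φ)
      ≈⟨ ∑-distrib-+ (funs m (a ℕ.+ b)) Ψˡ Ψʳ ⟩
    ∑ (funs m (a ℕ.+ b)) Ψˡ + ∑ (funs m (a ℕ.+ b)) Ψʳ
      ≈⟨ +-cong (∑-funs-+ m a b Ψˡ Ψˡ-cong) (∑-funs-+ m a b Ψʳ Ψʳ-cong) ⟩
    ∑ (funs m 2) (glued Ψˡ) + ∑ (funs m 2) (glued Ψʳ)
      ≈⟨ ∑-distrib-+ (funs m 2) (glued Ψˡ) (glued Ψʳ) ⟨
    ∑[ s ∈ funs m 2 ] (glued Ψˡ s + glued Ψʳ s)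
      ≈⟨ ∑-cong (funs m 2) (λ s → +-cong (glued-left s) (glued-right s)) ⟨
    ∑[ s ∈ funs m 2 ] (glued Φ (zero Vector.∷ s) + glued Φ (suc zero Vector.∷ s))
      ≈⟨ ∑-colourings-suc m (glued Φ) ⟨
    ∑ (funs (suc m) 2) (glued Φ) ∎
    where
    glued : ∀ {k} → ((Fin k → Fin (a ℕ.+ b)) → Carrier) → Colouring k → Carrier
    glued Θ s = ∑[ α ∈ funs (#left s) a ] ∑[ β ∈ funs (#right s) b ] Θ (glue s α β)

    Ψˡ Ψʳ : (Fin m → Fin (a ℕ.+ b)) → Carrier
    Ψˡ φ = ∑[ x ∈ allFins a ] Φ ((x ↑ˡ b) Vector.∷ φ)
    Ψʳ φ = ∑[ y ∈ allFins b ] Φ ((a ↑ʳ y) Vector.∷ φ)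

    Ψˡ-cong : PointwiseCongruent Ψˡ
    Ψˡ-cong φ≗ψ = ∑-cong (allFins a) (λ x → ∷-pointwiseCongruent Φ-cong _ φ≗ψ)
    Ψʳ-cong : PointwiseCongruent Ψʳ
    Ψʳ-cong φ≗ψ = ∑-cong (allFins b) (λ y → ∷-pointwiseCongruent Φ-cong _ φ≗ψ)

    glued-left : ∀ s → glued Φ (zero Vector.∷ s) ≈ glued Ψˡ s
    glued-left s = begin
      glued Φ (zero Vector.∷ s)
        ≈⟨ ∑-funs-suc (#left s) a _ ⟩
      ∑[ α ∈ funs (#left s) a ] ∑[ x ∈ allFins a ] ∑[ β ∈ funs (#right s) b ]
        Φ (glue (zero Vector.∷ s) (x Vector.∷ α) β)
        ≈⟨ ∑-cong (funs (#left s) a) (λ α → ∑-comm (allFins a) (funs (#right s) b) _) ⟩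
      ∑[ α ∈ funs (#left s) a ] ∑[ β ∈ funs (#right s) b ] ∑[ x ∈ allFins a ]
        Φ (glue (zero Vector.∷ s) (x Vector.∷ α) β)
        ≈⟨ ∑-cong (funs (#left s) a) (λ α → ∑-cong (funs (#right s) b) (λ β →
             ∑-cong (allFins a) (λ x → Φ-cong (glue-left s x α β)))) ⟩
      glued Ψˡ s ∎

    glued-right : ∀ s → glued Φ (suc zero Vector.∷ s) ≈ glued Ψʳ s
    glued-right s = ∑-cong (funs (#left s) a) (λ α → trans (∑-funs-suc (#right s) b _)
      (∑-cong (funs (#right s) b) (λ β → ∑-cong (allFins b) (λ y → Φ-cong (glue-right s y α β)))))

  edgeProduct : ∀ {m n} → (Fin n → Fin n → Carrier) → Edges m → (Fin m → Fin n) → Carrier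
  edgeProduct w es φ = ∏[ e ∈ es ] w (φ (proj₁ e)) (φ (proj₂ e))

  edgeProduct-cong : ∀ {m n} (w : Fin n → Fin n → Carrier) (es : Edges m) →
                     PointwiseCongruent (edgeProduct w es)
  edgeProduct-cong w es φ≗ψ = ∏-cong es (λ (u , v) → reflexive (≡.cong₂ w (φ≗ψ u) (φ≗ψ v)))

  weight-×G-combine : (F H : WGraph R) (x x′ : Fin (size F)) (y y′ : Fin (size H)) →
    weight (_×G_ R F H) (combine x y) (combine x′ y′) ≈ weight F x x′ * weight H y y′
  weight-×G-combine F H x x′ y y′ = *-cong
    (reflexive (≡.cong₂ (weight F) (≡.cong proj₁ xy) (≡.cong proj₁ x′y′)))
    (reflexive (≡.cong₂ (weight H) (≡.cong proj₂ xy) (≡.cong proj₂ x′y′)))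
    where
    xy  = remQuot-combine {size F} {size H} x y
    x′y′ = remQuot-combine {size F} {size H} x′ y′

  hom-×G : (G : MultiGraph) (F H : WGraph R) → hom R G (_×G_ R F H) ≈ hom R G F * hom R G H
  hom-×G G F H = begin
    hom R G (_×G_ R F H)
      ≈⟨ ∑-funs-* (vertices G) (size F) (size H) _ (edgeProduct-cong (weight (_×G_ R F H)) (edges G)) ⟩
    ∑[ α ∈ funs (vertices G) (size F) ] ∑[ β ∈ funs (vertices G) (size H) ]
      edgeProduct (weight (_×G_ R F H)) (edges G) (λ i → combine (α i) (β i))
      ≈⟨ ∑-cong (funs (vertices G) (size F)) (λ α → ∑-cong (funs (vertices G) (size H)) (λ β →
           trans (∏-cong (edges G) (λ _ → weight-×G-combine F H _ _ _ _))
                 (∏-distrib-* (edges G) _ _))) ⟩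
    ∑[ α ∈ funs (vertices G) (size F) ] ∑[ β ∈ funs (vertices G) (size H) ]
      (edgeProduct (weight F) (edges G) α * edgeProduct (weight H) (edges G) β)
      ≈⟨ ∑-*-∑ (funs (vertices G) (size F)) (funs (vertices G) (size H)) _ _ ⟩
    hom R G F * hom R G H ∎

  module _ (F H : WGraph R) where
    private
      a = size F
      b = size H
      w = weight (_∪G_ R F H)

    weight-∪G-↑ˡ-↑ˡ : ∀ x y → w (x ↑ˡ b) (y ↑ˡ b) ≈ weight F x y
    weight-∪G-↑ˡ-↑ˡ x y rewrite splitAt-↑ˡ a x b | splitAt-↑ˡ a y b = refl

    weight-∪G-↑ˡ-↑ʳ : ∀ x y → w (x ↑ˡ b) (a ↑ʳ y) ≈ 0#
    weight-∪G-↑ˡ-↑ʳ x y rewrite splitAt-↑ˡ a x b | splitAt-↑ʳ a b y = refl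

    weight-∪G-↑ʳ-↑ˡ : ∀ x y → w (a ↑ʳ x) (y ↑ˡ b) ≈ 0#
    weight-∪G-↑ʳ-↑ˡ x y rewrite splitAt-↑ʳ a b x | splitAt-↑ˡ a y b = refl

    weight-∪G-↑ʳ-↑ʳ : ∀ x y → w (a ↑ʳ x) (a ↑ʳ y) ≈ weight H x y
    weight-∪G-↑ʳ-↑ʳ x y rewrite splitAt-↑ʳ a b x | splitAt-↑ʳ a b y = refl

  crossFree : ∀ {m} → Colouring m → Edges m → Carrier
  crossFree s []             = 1#
  crossFree s ((u , v) ∷ es) with side s u | side s v
  ... | inj₁ _ | inj₁ _ = crossFree s es
  ... | inj₂ _ | inj₂ _ = crossFree s es
  ... | _      | _      = 0#

  edgeProduct-∪G-glue : ∀ {m} (F H : WGraph R) (s : Colouring m) α β (es : Edges m) →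
    edgeProduct (weight (_∪G_ R F H)) es (glue s α β) ≈
    crossFree s es * (edgeProduct (weight F) (leftEdges s es) α * edgeProduct (weight H) (rightEdges s es) β)
  edgeProduct-∪G-glue F H s α β [] = sym (trans (*-identityˡ _) (*-identityˡ _))
  edgeProduct-∪G-glue F H s α β ((u , v) ∷ es) with side s u | side s v
  ... | inj₁ _ | inj₁ _ = trans (*-cong (weight-∪G-↑ˡ-↑ˡ F H _ _) (edgeProduct-∪G-glue F H s α β es))
        (trans (*-Props.x∙yz≈y∙xz _ _ _) (*-cong refl (sym (*-assoc _ _ _))))
  ... | inj₁ _ | inj₂ _ = trans (*-cong (weight-∪G-↑ˡ-↑ʳ F H _ _) refl) (trans (zeroˡ _) (sym (zeroˡ _)))
  ... | inj₂ _ | inj₁ _ = trans (*-cong (weight-∪G-↑ʳ-↑ˡ F H _ _) refl) (trans (zeroˡ _) (sym (zeroˡ _)))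
  ... | inj₂ _ | inj₂ _ = trans (*-cong (weight-∪G-↑ʳ-↑ʳ F H _ _) (edgeProduct-∪G-glue F H s α β es))
        (trans (*-Props.x∙yz≈y∙xz _ _ _) (*-cong refl (*-Props.x∙yz≈y∙xz _ _ _)))

  hom-∪G : (G : MultiGraph) (F H : WGraph R) →
    hom R G (_∪G_ R F H) ≈
    ∑[ s ∈ funs (vertices G) 2 ]
      (crossFree s (edges G) * (hom R (leftSubgraph G s) F * hom R (rightSubgraph G s) H))
  hom-∪G G F H = begin
    hom R G (_∪G_ R F H)
      ≈⟨ ∑-funs-+ (vertices G) (size F) (size H) _ (edgeProduct-cong (weight (_∪G_ R F H)) (edges G)) ⟩
    ∑[ s ∈ funs (vertices G) 2 ] ∑[ α ∈ funs (#left s) (size F) ] ∑[ β ∈ funs (#right s) (size H) ]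
      edgeProduct (weight (_∪G_ R F H)) (edges G) (glue s α β)
      ≈⟨ ∑-cong (funs (vertices G) 2) (λ s → ∑-cong (funs (#left s) (size F)) (λ α →
           ∑-cong (funs (#right s) (size H)) (λ β → edgeProduct-∪G-glue F H s α β (edges G)))) ⟩
    ∑[ s ∈ funs (vertices G) 2 ] ∑[ α ∈ funs (#left s) (size F) ] ∑[ β ∈ funs (#right s) (size H) ]
      (crossFree s (edges G) * (edgeProduct (weight F) (leftEdges s (edges G)) α
                                * edgeProduct (weight H) (rightEdges s (edges G)) β))
      ≈⟨ ∑-cong (funs (vertices G) 2) (λ s → ∑-scaled-*-∑ (crossFree s (edges G))
           (funs (#left s) (size F)) (funs (#right s) (size H)) _ _) ⟩
    ∑[ s ∈ funs (vertices G) 2 ]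
      (crossFree s (edges G) * (hom R (leftSubgraph G s) F * hom R (rightSubgraph G s) H)) ∎

  Polynomial : ∀ {d} → (Index R d → Carrier) → Set (c ⊔ r)
  Polynomial {d} v = Σ ℕ λ m → Σ (Fin m → Poly R d) λ ps →
    (κ : Index R d) → Σ (Fin m) λ l → v κ ≈ eval R (ps l) (pt R κ)

  StronglyPolynomial : ∀ {d} → (Index R d → Carrier) → Set (c ⊔ r)
  StronglyPolynomial {d} v = Σ (Poly R d) λ p → (κ : Index R d) → v κ ≈ eval R p (pt R κ)

  rename : ∀ {l d} → (Fin l → Fin d) → Poly R l → Poly R d
  rename σ (con k) = con k
  rename σ (var i) = var (σ i)
  rename σ (p ⊕ q) = rename σ p ⊕ rename σ q
  rename σ (p ⊗ q) = rename σ p ⊗ rename σ q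

  eval-rename : ∀ {l d} (σ : Fin l → Fin d) p (x : Fin d → Carrier) →
                eval R (rename σ p) x ≈ eval R p (λ i → x (σ i))
  eval-rename σ (con k) x = refl
  eval-rename σ (var i) x = refl
  eval-rename σ (p ⊕ q) x = +-cong (eval-rename σ p x) (eval-rename σ q x)
  eval-rename σ (p ⊗ q) x = *-cong (eval-rename σ p x) (eval-rename σ q x)

  record ReindexableSubsemiring (P : ∀ {d} → (Index R d → Carrier) → Set (c ⊔ r)) : Set (c ⊔ r) where
    field
      respects : ∀ {d} {v w : Index R d → Carrier} → (∀ κ → v κ ≈ w κ) → P w → P v
      constant : ∀ {d} k → P {d} (λ _ → k)
      closed-+ : ∀ {d} {v w : Index R d → Carrier} → P v → P w → P (λ κ → v κ + w κ)
      closed-* : ∀ {d} {v w : Index R d → Carrier} → P v → P w → P (λ κ → v κ * w κ)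
      reindex  : ∀ {l d} (σ : Fin l → Fin d) {v : Index R l → Carrier} →
                 P v → P {d} (λ κ → v (λ i → κ (σ i)))

  polynomial-zip : ∀ {d} {u v w : Index R d → Carrier} (_⊙_ : Poly R d → Poly R d → Poly R d) →
    (∀ κ p q → v κ ≈ eval R p (pt R κ) → w κ ≈ eval R q (pt R κ) → u κ ≈ eval R (p ⊙ q) (pt R κ)) →
    Polynomial v → Polynomial w → Polynomial u
  polynomial-zip _⊙_ zip (m , ps , v≈) (n , qs , w≈) = m ℕ.* n , pairs , λ κ →
    combine (proj₁ (v≈ κ)) (proj₁ (w≈ κ)) ,
    trans (zip κ _ _ (proj₂ (v≈ κ)) (proj₂ (w≈ κ)))
          (reflexive (≡.cong (λ p → eval R p (pt R κ)) (≡.sym (pairs-combine _ _))))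
    where
    pairs : Fin (m ℕ.* n) → Poly R _
    pairs k = ps (proj₁ (remQuot {m} n k)) ⊙ qs (proj₂ (remQuot {m} n k))
    pairs-combine : ∀ i j → pairs (combine i j) ≡ ps i ⊙ qs j
    pairs-combine i j = ≡.cong (λ (i′ , j′) → ps i′ ⊙ qs j′) (remQuot-combine {m} {n} i j)

  polynomial-reindex : ∀ {l d} (σ : Fin l → Fin d) {v : Index R l → Carrier} →
                       Polynomial v → Polynomial {d} (λ κ → v (λ i → κ (σ i)))
  polynomial-reindex σ (m , ps , v≈) = m , (λ l → rename σ (ps l)) , λ κ →
    let (l , vσ≈) = v≈ (λ i → κ (σ i)) in l , trans vσ≈ (sym (eval-rename σ (ps l) (pt R κ)))

  polynomialSubsemiring : ReindexableSubsemiring Polynomial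
  polynomialSubsemiring = record
    { respects = λ v≈w (m , ps , w≈) → m , ps , λ κ → proj₁ (w≈ κ) , trans (v≈w κ) (proj₂ (w≈ κ))
    ; constant = λ k → 1 , (λ _ → con k) , λ κ → zero , refl
    ; closed-+ = polynomial-zip _⊕_ λ _ _ _ → +-cong
    ; closed-* = polynomial-zip _⊗_ λ _ _ _ → *-cong
    ; reindex  = polynomial-reindex
    }

  stronglyPolynomialSubsemiring : ReindexableSubsemiring StronglyPolynomial
  stronglyPolynomialSubsemiring = record
    { respects = λ v≈w (p , w≈) → p , λ κ → trans (v≈w κ) (w≈ κ)
    ; constant = λ k → con k , λ κ → refl
    ; closed-+ = λ (p , v≈) (q , w≈) → p ⊕ q , λ κ → +-cong (v≈ κ) (w≈ κ)
    ; closed-* = λ (p , v≈) (q , w≈) → p ⊗ q , λ κ → *-cong (v≈ κ) (w≈ κ)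
    ; reindex  = λ σ (p , v≈) → rename σ p , λ κ →
        trans (v≈ (λ i → κ (σ i))) (sym (eval-rename σ p (pt R κ)))
    }

  module _ {P : ∀ {d} → (Index R d → Carrier) → Set (c ⊔ r)} (class : ReindexableSubsemiring P) where
    open ReindexableSubsemiring class

    closed-∑ : ∀ {d} {A : Set} (xs : List A) (f : A → Index R d → Carrier) →
               (∀ x → P (f x)) → P (λ κ → ∑[ x ∈ xs ] f x κ)
    closed-∑ []       f Pf = constant 0#
    closed-∑ (x ∷ xs) f Pf = closed-+ (Pf x) (closed-∑ xs f Pf)

    -- Only the renamings σ and τ of a combination matter.
    module _ {l h d} (C : Combine R l h d) (F : Sequence R l) (H : Sequence R h)
             (PF : ∀ G → P (λ κ → hom R G (F κ))) (PH : ∀ G → P (λ κ → hom R G (H κ))) where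
      open Combine C using (σ; τ)

      private
        Fσ Hτ : Sequence R d
        Fσ κ = F (λ i → κ (σ i))
        Hτ κ = H (λ i → κ (τ i))

      homs-×G-closed : ∀ G → P (λ κ → hom R G (combineWith R (_×G_ R) C F H κ))
      homs-×G-closed G = respects (λ κ → hom-×G G (Fσ κ) (Hτ κ))
        (closed-* (reindex σ (PF G)) (reindex τ (PH G)))

      homs-∪G-closed : ∀ G → P (λ κ → hom R G (combineWith R (_∪G_ R) C F H κ))
      homs-∪G-closed G = respects (λ κ → hom-∪G G (Fσ κ) (Hτ κ))
        (closed-∑ (funs (vertices G) 2) _ λ s → closed-* (constant (crossFree s (edges G)))
          (closed-* (reindex σ (PF (leftSubgraph G s))) (reindex τ (PH (rightSubgraph G s)))))

proposition3p5 : ∀ {c r : Level} (R : CommutativeSemiring c r) {l h d : ℕ}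
    (C : Combine R l h d) (F : Sequence R l) (H : Sequence R h) →
    ((IsPolynomial R F → IsPolynomial R H →
        IsPolynomial R (combineWith R (_∪G_ R) C F H)
        × IsPolynomial R (combineWith R (_×G_ R) C F H))
    × (IsStronglyPolynomial R F → IsStronglyPolynomial R H →
        IsStronglyPolynomial R (combineWith R (_∪G_ R) C F H)
        × IsStronglyPolynomial R (combineWith R (_×G_ R) C F H)))
proposition3p5 R C F H =
    (λ PF PH → homs-∪G-closed R (polynomialSubsemiring R) C F H PF PH
             , homs-×G-closed R (polynomialSubsemiring R) C F H PF PH)
  , (λ PF PH → homs-∪G-closed R (stronglyPolynomialSubsemiring R) C F H PF PH
             , homs-×G-closed R (stronglyPolynomialSubsemiring R) C F H PF PH)
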